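{- Let $H=H(b,\delta,\lambda)$ be a balanced HST, let $W$ be a random $n$-element submultiset of its leaves, and let $v$ be a non-root vertex in level $\ell$ of $H$. Then $\Pr[X(v)\text{ is odd}]\le\frac12$, so $\mathbf{E}[Odd(X(v))]\le\frac12$. If $n\ge b^{\ell}$, then $\Pr[X(v)\text{ is odd}]\ge\frac14$, so $\mathbf{E}[Odd(X(v))]\ge\frac14$.
   Context: A balanced HST $H(b,\delta,\lambda)$ (integers $b\ge2$, $\delta\ge1$, real $0<\lambda<1$) is a rooted tree in which every non-leaf vertex has exactly $b$ children and every leaf is at depth $\delta$; the root is at level $0$ and level $\ell$ has $b^\ell$ vertices. A random $n$-element submultiset of the leaves is obtained by choosing $n$ leaves independently and uniformly at random (repetitions allowed). $X(v)$ is the number of chosen points located at leaves descending from $v$ (a vertex is its own descendant). $Odd(N)=1$ if $N$ is odd and $0$ otherwise. -}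

module Defs where

open import Data.Nat using (ℕ; zero; suc; _+_)
open import Data.Bool using (Bool; true; false; _∧_; if_then_else_)
open import Data.Fin using (Fin)
import Data.Fin as Fin
open import Data.Vec using (Vec; []; _∷_)
open import Data.List using (List; [_]; concatMap; map; allFin)
open import Data.Nat.ListAction using (sum)
open import Relation.Nullary.Decidable using (⌊_⌋)

allVecs : {A : Set} → List A → (n : ℕ) → List (Vec A n)
allVecs xs zero    = [ [] ]
allVecs xs (suc n) = concatMap (λ x → map (x ∷_) (allVecs xs n)) xs

-- Balanced HST H(b,δ,λ): a vertex at level ℓ is identified with its path
-- from the root, i.e. a vector in Fin b of length ℓ; leaves are the
-- vertices at level δ.
Vertex : ℕ → ℕ → Set
Vertex b ℓ = Vec (Fin b) ℓ

Leaf : ℕ → ℕ → Set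
Leaf b δ = Vertex b δ

leaves : (b δ : ℕ) → List (Leaf b δ)
leaves b δ = allVecs (allFin b) δ

descendsFrom : {b ℓ δ : ℕ} → Vertex b δ → Vertex b ℓ → Bool
descendsFrom w       []      = true
descendsFrom []      (x ∷ v) = false
descendsFrom (y ∷ w) (x ∷ v) = ⌊ x Fin.≟ y ⌋ ∧ descendsFrom w v

-- Sample space of the random n-element submultiset: n leaves chosen
-- independently and uniformly (ordered n-tuples, all equally likely).
sampleSpace : (b δ n : ℕ) → List (Vec (Leaf b δ) n)
sampleSpace b δ n = allVecs (leaves b δ) n

X : {b ℓ δ n : ℕ} → Vertex b ℓ → Vec (Leaf b δ) n → ℕ
X v []      = 0
X v (w ∷ W) = (if descendsFrom w v then 1 else 0) + X v W

Odd : ℕ → ℕ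
Odd zero          = 0
Odd (suc zero)    = 1
Odd (suc (suc n)) = Odd n

-- Σ over the sample space of Odd(X(v)); equals |Ω| · Pr[X(v) odd] = |Ω| · E[Odd(X(v))].
oddMass : (b δ n : ℕ) {ℓ : ℕ} → Vertex b ℓ → ℕ
oddMass b δ n v = sum (map (λ W → Odd (X v W)) (sampleSpace b δ n))

-- Let K be the number of leaves below v and N the number of the others, so that the sample
-- space has (K + N)ⁿ points.  Splitting on the first chosen leaf shows that the odd and even
-- masses O n, E n satisfy O (n+1) = K E n + N O n and E (n+1) = K O n + N E n; hence
-- O n + E n = (K + N)ⁿ and E n − O n = (N − K)ⁿ, i.e. 2 O n = (K + N)ⁿ − (N − K)ⁿ.
-- Since K bˡ = K + N with bˡ ≥ 2 we have K ≤ N, which gives the upper bound.  When n ≥ bˡ,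
-- N − K ≤ N ≤ n K, and Bernoulli's inequality gives (K + N)ⁿ ≥ 2 (N − K)ⁿ, the lower bound.
module Submission where

open import Defs
open import Data.Nat using (ℕ; zero; suc; _+_; _*_; _^_; _∸_; _≤_; z≤n; s≤s)
open import Data.Nat.Properties
open import Data.Nat.ListAction using (sum)
open import Data.Nat.ListAction.Properties using (sum-++)
open import Data.Nat.Solver using (module +-*-Solver)
open import Data.Bool using (Bool; true; false; if_then_else_)
open import Data.Fin using (Fin)
import Data.Fin as Fin
open import Data.Vec using (Vec; []; _∷_)
open import Data.List using (List; []; _∷_; _++_; length; map; concatMap; allFin; tabulate)
open import Data.List.Properties using (map-++; map-∘; map-cong; map-tabulate; tabulate-cong; length-++; length-map; length-tabulate)
open import Data.Product using (_×_; _,_)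
open import Relation.Nullary using (yes; no)
open import Relation.Nullary.Decidable using (⌊_⌋)
open import Relation.Binary.PropositionalEquality
open +-*-Solver

sum-map-concatMap : {A B : Set} (f : B → ℕ) (g : A → List B) (xs : List A) →
  sum (map f (concatMap g xs)) ≡ sum (map (λ x → sum (map f (g x))) xs)
sum-map-concatMap f g [] = refl
sum-map-concatMap f g (x ∷ xs) = begin
    sum (map f (g x ++ concatMap g xs))
  ≡⟨ cong sum (map-++ f (g x) (concatMap g xs)) ⟩
    sum (map f (g x) ++ map f (concatMap g xs))
  ≡⟨ sum-++ (map f (g x)) (map f (concatMap g xs)) ⟩
    sum (map f (g x)) + sum (map f (concatMap g xs))
  ≡⟨ cong (sum (map f (g x)) +_) (sum-map-concatMap f g xs) ⟩
    sum (map f (g x)) + sum (map (λ x → sum (map f (g x))) xs) ∎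
  where open ≡-Reasoning

sum-map-allVecs-suc : {A : Set} (xs : List A) (n : ℕ) (f : Vec A (suc n) → ℕ) →
  sum (map f (allVecs xs (suc n))) ≡ sum (map (λ x → sum (map (λ ws → f (x ∷ ws)) (allVecs xs n))) xs)
sum-map-allVecs-suc xs n f =
  trans (sum-map-concatMap f (λ x → map (x ∷_) (allVecs xs n)) xs)
        (cong sum (map-cong (λ x → cong sum (sym (map-∘ (allVecs xs n)))) xs))

length-allVecs : {A : Set} (xs : List A) (n : ℕ) → length (allVecs xs n) ≡ length xs ^ n
length-allVecs xs zero = refl
length-allVecs xs (suc n) = go xs
  where
  go : ∀ ys → length (concatMap (λ y → map (y ∷_) (allVecs xs n)) ys) ≡ length ys * length xs ^ n
  go [] = refl
  go (y ∷ ys) = trans (length-++ (map (y ∷_) (allVecs xs n)))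
    (cong₂ _+_ (trans (length-map (y ∷_) (allVecs xs n)) (length-allVecs xs n)) (go ys))

length-leaves : (b δ : ℕ) → length (leaves b δ) ≡ b ^ δ
length-leaves b δ = trans (length-allVecs (allFin b) δ) (cong (_^ δ) (length-tabulate (λ i → i)))

count countNot : {A : Set} → (A → Bool) → List A → ℕ
count    p xs = sum (map (λ x → if p x then 1 else 0) xs)
countNot p xs = sum (map (λ x → if p x then 0 else 1) xs)

count+countNot≡length : {A : Set} (p : A → Bool) (xs : List A) → count p xs + countNot p xs ≡ length xs
count+countNot≡length p [] = refl
count+countNot≡length p (x ∷ xs) with p x
... | true  = cong suc (count+countNot≡length p xs)
... | false = trans (+-suc (count p xs) (countNot p xs)) (cong suc (count+countNot≡length p xs))

sum-map-if : {A : Set} (p : A → Bool) (a c : ℕ) (xs : List A) →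
  sum (map (λ x → if p x then a else c) xs) ≡ count p xs * a + countNot p xs * c
sum-map-if p a c [] = refl
sum-map-if p a c (x ∷ xs) with p x
... | true  rewrite sum-map-if p a c xs =
  solve 4 (λ a c k l → a :+ (k :* a :+ l :* c) := (con 1 :+ k) :* a :+ l :* c) refl a c (count p xs) (countNot p xs)
... | false rewrite sum-map-if p a c xs =
  solve 4 (λ a c k l → c :+ (k :* a :+ l :* c) := k :* a :+ (con 1 :+ l) :* c) refl a c (count p xs) (countNot p xs)

sum-map-zero : {A : Set} (xs : List A) → sum (map (λ _ → 0) xs) ≡ 0
sum-map-zero []       = refl
sum-map-zero (_ ∷ xs) = sum-map-zero xs

sum-indicator-allFin : {b : ℕ} (x : Fin b) (c : ℕ) →
  sum (map (λ y → if ⌊ x Fin.≟ y ⌋ then c else 0) (allFin b)) ≡ c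
sum-indicator-allFin {b} x c =
  trans (cong sum (map-tabulate (λ i → i) (λ y → if ⌊ x Fin.≟ y ⌋ then c else 0))) (sum-tabulate x)
  where
  sum-tabulate : {n : ℕ} (x : Fin n) → sum (tabulate (λ y → if ⌊ x Fin.≟ y ⌋ then c else 0)) ≡ c
  sum-tabulate {suc n} Fin.zero    =
    trans (cong (λ zs → c + sum zs) (sym (map-tabulate {n = n} (λ i → i) (λ _ → 0))))
          (trans (cong (c +_) (sum-map-zero (allFin n))) (+-identityʳ c))
  sum-tabulate {suc n} (Fin.suc x) = trans (cong sum (tabulate-cong peel)) (sum-tabulate x)
    where
    peel : ∀ y → (if ⌊ Fin.suc x Fin.≟ Fin.suc y ⌋ then c else 0) ≡ (if ⌊ x Fin.≟ y ⌋ then c else 0)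
    peel y with x Fin.≟ y
    ... | yes _ = refl
    ... | no _  = refl

below : {b ℓ δ : ℕ} → Vertex b ℓ → Leaf b δ → Bool
below v w = descendsFrom w v

count-below-∷ : (b δ : ℕ) {ℓ : ℕ} (x : Fin b) (v : Vertex b ℓ) →
  count (below (x ∷ v)) (leaves b (suc δ)) ≡ count (below v) (leaves b δ)
count-below-∷ b δ x v = begin
    count (below (x ∷ v)) (leaves b (suc δ))
  ≡⟨ sum-map-allVecs-suc (allFin b) δ (λ w → if below (x ∷ v) w then 1 else 0) ⟩
    sum (map (λ y → sum (map (λ w → if below (x ∷ v) (y ∷ w) then 1 else 0) (leaves b δ))) (allFin b))
  ≡⟨ cong sum (map-cong by-first-coordinate (allFin b)) ⟩
    sum (map (λ y → if ⌊ x Fin.≟ y ⌋ then count (below v) (leaves b δ) else 0) (allFin b))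
  ≡⟨ sum-indicator-allFin x (count (below v) (leaves b δ)) ⟩
    count (below v) (leaves b δ) ∎
  where
  open ≡-Reasoning
  by-first-coordinate : ∀ y → sum (map (λ w → if below (x ∷ v) (y ∷ w) then 1 else 0) (leaves b δ))
                   ≡ (if ⌊ x Fin.≟ y ⌋ then count (below v) (leaves b δ) else 0)
  by-first-coordinate y with x Fin.≟ y
  ... | yes _ = refl
  ... | no _  = sum-map-zero (leaves b δ)

count-below*b^ℓ : (b δ : ℕ) {ℓ : ℕ} → ℓ ≤ δ → (v : Vertex b ℓ) →
  count (below v) (leaves b δ) * b ^ ℓ ≡ b ^ δ
count-below*b^ℓ b δ z≤n [] = trans (*-identityʳ _) (trans (count-all (leaves b δ)) (length-leaves b δ))
  where
  count-all : (xs : List (Leaf b δ)) → count (below []) xs ≡ length xs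
  count-all []       = refl
  count-all (_ ∷ xs) = cong suc (count-all xs)
count-below*b^ℓ b (suc δ) {suc ℓ} (s≤s ℓ≤δ) (x ∷ v) = begin
    count (below (x ∷ v)) (leaves b (suc δ)) * (b * b ^ ℓ)
  ≡⟨ cong (_* (b * b ^ ℓ)) (count-below-∷ b δ x v) ⟩
    k * (b * b ^ ℓ)
  ≡⟨ solve 3 (λ k b p → k :* (b :* p) := b :* (k :* p)) refl k b (b ^ ℓ) ⟩
    b * (k * b ^ ℓ)
  ≡⟨ cong (b *_) (count-below*b^ℓ b δ ℓ≤δ v) ⟩
    b * b ^ δ ∎
  where
  open ≡-Reasoning
  k = count (below v) (leaves b δ)

bernoulli : ∀ a c m → a ^ suc m + suc m * c * a ^ m ≤ (a + c) ^ suc m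
bernoulli a c zero = ≤-reflexive (solve 2 (λ a c → a :* con 1 :+ (con 1 :* c) :* con 1 := (a :+ c) :* con 1) refl a c)
bernoulli a c (suc m) = begin
    a ^ suc (suc m) + suc (suc m) * c * a ^ suc m
  ≤⟨ m≤m+n _ (suc m * c * c * a ^ m) ⟩
    a ^ suc (suc m) + suc (suc m) * c * a ^ suc m + suc m * c * c * a ^ m
  ≡⟨ solve 4 (λ a c p m → a :* (a :* p) :+ (con 1 :+ (con 1 :+ m)) :* c :* (a :* p) :+ (con 1 :+ m) :* c :* c :* p
               := (a :+ c) :* (a :* p :+ (con 1 :+ m) :* c :* p)) refl a c (a ^ m) m ⟩
    (a + c) * (a ^ suc m + suc m * c * a ^ m)
  ≤⟨ *-monoʳ-≤ (a + c) (bernoulli a c m) ⟩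
    (a + c) ^ suc (suc m) ∎
  where open ≤-Reasoning

^-doubling : ∀ r c m → r ≤ suc m * c → r ^ suc m + r ^ suc m ≤ (r + c) ^ suc m
^-doubling r c m r≤ = ≤-trans (+-monoʳ-≤ (r ^ suc m) (*-monoˡ-≤ (r ^ m) r≤)) (bernoulli r c m)

Even : ℕ → ℕ
Even k = Odd (suc k)

module ParityMass {b ℓ δ : ℕ} (v : Vertex b ℓ) (xs : List (Leaf b δ)) where

  inside outside : ℕ
  inside  = count (below v) xs
  outside = countNot (below v) xs

  mass : (ℕ → ℕ) → ℕ → ℕ
  mass P n = sum (map (λ W → P (X v W)) (allVecs xs n))

  odd even : ℕ → ℕ
  odd  = mass Odd
  even = mass Even

  -- Even (suc k) and Odd (suc k) reduce to Odd k and Even k, so both recurrences are instances.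
  mass-suc : (P : ℕ → ℕ) (n : ℕ) → mass P (suc n) ≡ inside * mass (λ k → P (suc k)) n + outside * mass P n
  mass-suc P n = begin
      mass P (suc n)
    ≡⟨ sum-map-allVecs-suc xs n (λ W → P (X v W)) ⟩
      sum (map (λ y → sum (map (λ W → P (X v (y ∷ W))) (allVecs xs n))) xs)
    ≡⟨ cong sum (map-cong first-leaf xs) ⟩
      sum (map (λ y → if below v y then mass (λ k → P (suc k)) n else mass P n) xs)
    ≡⟨ sum-map-if (below v) _ _ xs ⟩
      inside * mass (λ k → P (suc k)) n + outside * mass P n ∎
    where
    open ≡-Reasoning
    first-leaf : ∀ y → sum (map (λ W → P (X v (y ∷ W))) (allVecs xs n))
                     ≡ (if below v y then mass (λ k → P (suc k)) n else mass P n)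
    first-leaf y with descendsFrom y v
    ... | true  = refl
    ... | false = refl

  length-sampleSpace : ∀ n → length (allVecs xs n) ≡ (inside + outside) ^ n
  length-sampleSpace n =
    trans (length-allVecs xs n) (cong (_^ n) (sym (count+countNot≡length (below v) xs)))

  odd+even : ∀ n → odd n + even n ≡ (inside + outside) ^ n
  odd+even zero = refl
  odd+even (suc n) rewrite mass-suc Odd n | mass-suc Even n | sym (odd+even n) =
    solve 4 (λ k l o e → k :* e :+ l :* o :+ (k :* o :+ l :* e) := (k :+ l) :* (o :+ e))
      refl inside outside (odd n) (even n)

  even≡odd+^ : ∀ r → outside ≡ inside + r → ∀ n → even n ≡ odd n + r ^ n
  even≡odd+^ r eq zero = refl
  even≡odd+^ r eq (suc n) rewrite mass-suc Odd n | mass-suc Even n | even≡odd+^ r eq n | eq =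
    solve 4 (λ k r o p → k :* o :+ (k :+ r) :* (o :+ p) := (k :* (o :+ p) :+ (k :+ r) :* o) :+ r :* p)
      refl inside r (odd n) (r ^ n)

  length≡odd+odd+^ : inside ≤ outside → ∀ n →
    length (allVecs xs n) ≡ odd n + (odd n + (outside ∸ inside) ^ n)
  length≡odd+odd+^ k≤l n = begin
      length (allVecs xs n)                          ≡⟨ length-sampleSpace n ⟩
      (inside + outside) ^ n                         ≡⟨ sym (odd+even n) ⟩
      odd n + even n                                 ≡⟨ cong (odd n +_) (even≡odd+^ _ (sym (m+[n∸m]≡n k≤l)) n) ⟩
      odd n + (odd n + (outside ∸ inside) ^ n)       ∎
    where open ≡-Reasoning

  2*odd≤length : inside ≤ outside → ∀ n → 2 * odd n ≤ length (allVecs xs n)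
  2*odd≤length k≤l n rewrite length≡odd+odd+^ k≤l n =
    +-monoʳ-≤ (odd n) (≤-trans (≤-reflexive (+-identityʳ (odd n))) (m≤m+n (odd n) _))

  length≤4*odd : inside ≤ outside → ∀ {n} → outside ≤ n * inside → 1 ≤ n → length (allVecs xs n) ≤ 4 * odd n
  length≤4*odd k≤l {n@(suc m)} l≤nk (s≤s z≤n) = begin
      length (allVecs xs n)                   ≡⟨ length≡odd+odd+^ k≤l n ⟩
      odd n + (odd n + r ^ n)                 ≤⟨ +-monoʳ-≤ (odd n) (+-monoʳ-≤ (odd n) r^n≤2*odd) ⟩
      odd n + (odd n + (odd n + odd n))       ≡⟨ solve 1 (λ o → o :+ (o :+ (o :+ o)) := con 4 :* o) refl (odd n) ⟩
      4 * odd n                               ∎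
    where
    open ≤-Reasoning
    r = outside ∸ inside
    r≤n*2k : r ≤ n * (inside + inside)
    r≤n*2k = ≤-trans (m∸n≤m outside inside) (≤-trans l≤nk (*-monoʳ-≤ n (m≤m+n inside inside)))
    r^n+r^n≤length : r ^ n + r ^ n ≤ r ^ n + (odd n + odd n)
    r^n+r^n≤length = begin
        r ^ n + r ^ n                 ≤⟨ ^-doubling r (inside + inside) m r≤n*2k ⟩
        (r + (inside + inside)) ^ n   ≡⟨ cong (_^ n) (solve 2 (λ k r → r :+ (k :+ k) := k :+ (k :+ r)) refl inside r) ⟩
        (inside + (inside + r)) ^ n   ≡⟨ cong (λ l → (inside + l) ^ n) (m+[n∸m]≡n k≤l) ⟩
        (inside + outside) ^ n        ≡⟨ trans (sym (length-sampleSpace n)) (length≡odd+odd+^ k≤l n) ⟩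
        odd n + (odd n + r ^ n)       ≡⟨ solve 2 (λ o p → o :+ (o :+ p) := p :+ (o :+ o)) refl (odd n) (r ^ n) ⟩
        r ^ n + (odd n + odd n)       ∎
    r^n≤2*odd : r ^ n ≤ odd n + odd n
    r^n≤2*odd = +-cancelˡ-≤ (r ^ n) (r ^ n) (odd n + odd n) r^n+r^n≤length

lemma2 : (b δ ℓ n : ℕ) → 2 ≤ b → 1 ≤ δ → 1 ≤ ℓ → ℓ ≤ δ → (v : Vec (Fin b) ℓ) →
    (2 * oddMass b δ n v ≤ length (sampleSpace b δ n))
    × (b ^ ℓ ≤ n → length (sampleSpace b δ n) ≤ 4 * oddMass b δ n v)
lemma2 b@(suc _) δ ℓ n 2≤b _ 1≤ℓ ℓ≤δ v =
  2*odd≤length inside≤outside n ,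
  λ bˡ≤n → length≤4*odd inside≤outside (outside≤n*inside bˡ≤n) (≤-trans 1≤bˡ bˡ≤n)
  where
  open ParityMass v (leaves b δ)
  scaling : inside * b ^ ℓ ≡ inside + outside
  scaling = trans (count-below*b^ℓ b δ ℓ≤δ v)
    (sym (trans (count+countNot≡length (below v) (leaves b δ)) (length-leaves b δ)))
  2≤bˡ : 2 ≤ b ^ ℓ
  2≤bˡ = ≤-trans 2≤b (≤-trans (m≤m*n b 1) (^-monoʳ-≤ b 1≤ℓ))
  1≤bˡ : 1 ≤ b ^ ℓ
  1≤bˡ = ≤-trans (s≤s z≤n) 2≤bˡ
  inside≤outside : inside ≤ outside
  inside≤outside = +-cancelˡ-≤ inside inside outside (begin
    inside + inside   ≡⟨ solve 1 (λ k → k :+ k := k :* con 2) refl inside ⟩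
    inside * 2        ≤⟨ *-monoʳ-≤ inside 2≤bˡ ⟩
    inside * b ^ ℓ    ≡⟨ scaling ⟩
    inside + outside  ∎)
    where open ≤-Reasoning
  outside≤n*inside : b ^ ℓ ≤ n → outside ≤ n * inside
  outside≤n*inside bˡ≤n = begin
    outside           ≤⟨ m≤n+m outside inside ⟩
    inside + outside  ≡⟨ sym scaling ⟩
    inside * b ^ ℓ    ≤⟨ *-monoʳ-≤ inside bˡ≤n ⟩
    inside * n        ≡⟨ *-comm inside n ⟩
    n * inside        ∎
    where open ≤-Reasoning
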